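{- Let $C$ be a polygonal chain of $n$ planar points, let $\langle \ell_1,\dots,\ell_m\rangle$ be the sizes of the subchains represented by the $m$ leaves of the recursion tree of the Test-And-Divide algorithm on input $C$ (so $n=\sum_{i=1}^m\ell_i$), and let $\omega$ be the width of this recursion tree. Then the running time of the Test-And-Divide algorithm on $C$ is within $O(n(1+\mathcal{H}(\ell_1,\dots,\ell_m)))\subseteq O(\omega n)\cap O(n\log m)\subseteq O(n\log n)$.
   Context: A polygonal chain is a sequence of points $p_1,\dots,p_n$ in the plane together with the segments joining consecutive points. It is simple if any two non-adjacent edges are disjoint or meet only at a vertex of the chain, and any two adjacent edges share only their common vertex. The Test-And-Divide algorithm computes the convex hull of a polygonal chain $C$: it tests in linear time whether $C$ is simple; if so it computes the convex hull of $C$ in linear time (Melkman's algorithm) and this call is a leaf of the recursion; otherwise it cuts $C$ into two consecutive subchains of sizes $\lceil n/2\rceil$ and $\lfloor n/2\rfloor$, recurses on each, and merges the two resulting convex hulls in linear time. Each node of the recursion tree corresponds to a subchain and costs time linear in its size. The width of the recursion tree is the maximum number of nodes at any level. For positive integers $n_1,\dots,n_k$ summing to $n$, $\mathcal{H}(n_1,\dots,n_k)=\sum_{i=1}^k\frac{n_i}{n}\log\frac{n}{n_i}$.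
   Formalization: The points of the chain C have rational coordinates. -}

module Defs where

open import Data.Nat as ℕ using (ℕ; zero; suc; _+_; _*_; _^_; _≤_; _<_; _⊔_; ⌈_/2⌉)
open import Data.Fin using (Fin; toℕ)
open import Data.List using (List; []; _∷_; length; take; drop; map; foldr)
open import Data.Nat.ListAction using (sum; product)
open import Data.List.Membership.Propositional using (_∈_)
open import Data.Rational as ℚ using (ℚ; 0ℚ; 1ℚ)
open import Data.Product using (_×_; _,_; proj₁; proj₂; ∃-syntax)
open import Relation.Binary.PropositionalEquality using (_≡_)
open import Relation.Nullary using (¬_)

Point : Set
Point = ℚ × ℚ

Segment : Set
Segment = Point × Point

_∈Seg_ : Point → Segment → Set
(x , y) ∈Seg ((ax , ay) , (bx , by)) =
  ∃[ t ] (0ℚ ℚ.≤ t × t ℚ.≤ 1ℚ ×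
          x ≡ ax ℚ.+ t ℚ.* (bx ℚ.- ax) × y ≡ ay ℚ.+ t ℚ.* (by ℚ.- ay))

Chain : Set
Chain = List Point

edges : Chain → List Segment
edges (a ∷ b ∷ rest) = (a , b) ∷ edges (b ∷ rest)
edges _              = []

Simple : Chain → Set
Simple C =
  (∀ (i j : Fin (length (edges C))) → suc (toℕ i) < toℕ j →
     ∀ x → x ∈Seg Data.List.lookup (edges C) i → x ∈Seg Data.List.lookup (edges C) j →
     x ∈ C)
  × (∀ (i j : Fin (length (edges C))) → toℕ j ≡ suc (toℕ i) →
     ∀ x → x ∈Seg Data.List.lookup (edges C) i → x ∈Seg Data.List.lookup (edges C) j →
     x ≡ proj₂ (Data.List.lookup (edges C) i))

-- Recursion tree of Test-And-Divide on a chain C: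
-- a leaf if C is simple; otherwise C is cut into its first ⌈n/2⌉ and its
-- last ⌊n/2⌋ points and the algorithm recurses on both parts.

data RecTree : Chain → Set where
  leaf : ∀ {C} → Simple C → RecTree C
  node : ∀ {C} → ¬ Simple C →
         RecTree (take ⌈ length C /2⌉ C) →
         RecTree (drop ⌈ length C /2⌉ C) →
         RecTree C

-- Running time (cost model): each node costs time linear in the size of
-- its subchain, so the running time is Θ(sum of the sizes of all nodes).
cost : ∀ {C} → RecTree C → ℕ
cost {C} (leaf _)     = length C
cost {C} (node _ l r) = length C + cost l + cost r

leafSizes : ∀ {C} → RecTree C → List ℕ
leafSizes {C} (leaf _)     = length C ∷ []
leafSizes     (node _ l r) = leafSizes l Data.List.++ leafSizes r

addLevels : List ℕ → List ℕ → List ℕ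
addLevels []       ys       = ys
addLevels xs       []       = xs
addLevels (x ∷ xs) (y ∷ ys) = (x + y) ∷ addLevels xs ys

levelCounts : ∀ {C} → RecTree C → List ℕ
levelCounts (leaf _)     = 1 ∷ []
levelCounts (node _ l r) = 1 ∷ addLevels (levelCounts l) (levelCounts r)

width : ∀ {C} → RecTree C → ℕ
width t = foldr _⊔_ 0 (levelCounts t)

-- Entropy bounds, encoded exactly in integer arithmetic.
-- For ls = ⟨n₁,…,n_k⟩ with N = Σ nᵢ and H = H(ls) with logarithms base 2,
--   N·H = log₂ (N^N / Π nᵢ^nᵢ).

-- "a ≤ c · N · (1 + H(ls))"
CostLe : ℕ → ℕ → List ℕ → Set
CostLe a c ls =
  2 ^ a * product (map (λ ℓ → ℓ ^ (c * ℓ)) ls) ≤ 2 ^ (c * sum ls) * sum ls ^ (c * sum ls)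

-- "N · (1 + H(ls)) ≤ c · w · N"
EntLeMul : ℕ → ℕ → List ℕ → Set
EntLeMul c w ls =
  2 ^ sum ls * sum ls ^ sum ls ≤ 2 ^ (c * w * sum ls) * product (map (λ ℓ → ℓ ^ ℓ) ls)

-- "N · (1 + H(ls)) ≤ c · N · (1 + log₂ y)"
EntLeLog : ℕ → ℕ → List ℕ → Set
EntLeLog c y ls =
  2 ^ sum ls * sum ls ^ sum ls
    ≤ 2 ^ (c * sum ls) * y ^ (c * sum ls) * product (map (λ ℓ → ℓ ^ ℓ) ls)

-- Write N for the size of the input chain, ℓ₁ … ℓₘ for the leaf sizes, P_k for
-- Πᵢ ℓᵢ^(k·ℓᵢ) and w for the width.  Since N·H(ℓ) = log₂ (N^N / P₁), every claim
-- is an inequality between natural numbers: with c = 7 we show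
--   (a) cost ≤ 7N(1+H)       :  2^cost · P₇ ≤ (2N)^(7N),
--   (b) N(1+H) ≤ 7wN,  (c) N(1+H) ≤ 7N(1+log m),  (d) N(1+H) ≤ 7N(1+log N).
-- The only thing the proof uses about the tree is that every inner node splits
-- its size N into a balanced pair a = ⌈N/2⌉ ≥ b = ⌊N/2⌋ ≥ 1 (a non-simple chain
-- has at least two points).
module Submission where

open import Defs
open import Data.Nat
open import Data.Nat.Properties
open import Data.Nat.Tactic.RingSolver using (solve-∀)
open import Algebra.Properties.CommutativeSemigroup *-commutativeSemigroup
  using (interchange; x∙yz≈y∙xz)
open import Algebra.Properties.CommutativeSemigroup +-commutativeSemigroup
  using () renaming (interchange to +-interchange)
open import Data.Nat.ListAction using (sum; product)
open import Data.Nat.ListAction.Properties using (sum-++; product-++)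
open import Data.List using (List; []; _∷_; length; take; drop; map; foldr; _++_)
open import Data.List.Properties using (length-take; length-drop; length-++; map-++)
open import Data.Product using (_×_; _,_; ∃-syntax)
open import Data.Sum using (inj₁; inj₂)
open import Data.Empty using (⊥-elim)
open import Relation.Binary.PropositionalEquality
open import Relation.Nullary using (¬_)

*-^-distrib : ∀ m n k → (m * n) ^ k ≡ m ^ k * n ^ k
*-^-distrib m n zero    = refl
*-^-distrib m n (suc k) = begin
    m * n * (m * n) ^ k      ≡⟨ cong (m * n *_) (*-^-distrib m n k) ⟩
    m * n * (m ^ k * n ^ k)  ≡⟨ interchange m n (m ^ k) (n ^ k) ⟩
    m * m ^ k * (n * n ^ k)  ∎
  where open ≡-Reasoning

^-split : ∀ m a b {N} → a + b ≡ N → m ^ a * m ^ b ≡ m ^ N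
^-split m a b a+b≡N = trans (sym (^-distribˡ-+-* m a b)) (cong (m ^_) a+b≡N)

^-*-split : ∀ m k a b {N} → a + b ≡ N → m ^ (k * a) * m ^ (k * b) ≡ m ^ (k * N)
^-*-split m k a b a+b≡N = ^-split m (k * a) (k * b) (trans (sym (*-distribˡ-+ k a b)) (cong (k *_) a+b≡N))

^-node : ∀ m N cl cr → m ^ (N + cl + cr) ≡ m ^ N * (m ^ cl * m ^ cr)
^-node m N cl cr = begin
    m ^ (N + cl + cr)        ≡⟨ ^-distribˡ-+-* m (N + cl) cr ⟩
    m ^ (N + cl) * m ^ cr    ≡⟨ cong (_* m ^ cr) (^-distribˡ-+-* m N cl) ⟩
    m ^ N * m ^ cl * m ^ cr  ≡⟨ *-assoc (m ^ N) (m ^ cl) (m ^ cr) ⟩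
    m ^ N * (m ^ cl * m ^ cr) ∎
  where open ≡-Reasoning

^-node-weighted : ∀ m N cl cr Pl Pr →
  m ^ (N + cl + cr) * (Pl * Pr) ≡ m ^ N * ((m ^ cl * Pl) * (m ^ cr * Pr))
^-node-weighted m N cl cr Pl Pr = begin
    m ^ (N + cl + cr) * (Pl * Pr)              ≡⟨ cong (_* (Pl * Pr)) (^-node m N cl cr) ⟩
    m ^ N * (m ^ cl * m ^ cr) * (Pl * Pr)      ≡⟨ *-assoc (m ^ N) _ _ ⟩
    m ^ N * ((m ^ cl * m ^ cr) * (Pl * Pr))    ≡⟨ cong (m ^ N *_) (interchange (m ^ cl) (m ^ cr) Pl Pr) ⟩
    m ^ N * ((m ^ cl * Pl) * (m ^ cr * Pr))    ∎
  where open ≡-Reasoning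

n≤k*n : ∀ {k n} → 1 ≤ k → n ≤ k * n
n≤k*n {k} {n} 1≤k = ≤-trans (≤-reflexive (sym (*-identityˡ n))) (*-monoˡ-≤ n 1≤k)

absorb-2^ : ∀ {N u v e} → 2 * u ≤ v → N ≤ e → 2 ^ N * u ^ e ≤ v ^ e
absorb-2^ {N} {u} {v} {e} 2u≤v N≤e = begin
    2 ^ N * u ^ e  ≤⟨ *-monoˡ-≤ (u ^ e) (^-monoʳ-≤ 2 N≤e) ⟩
    2 ^ e * u ^ e  ≡⟨ *-^-distrib 2 u e ⟨
    (2 * u) ^ e    ≤⟨ ^-monoˡ-≤ e 2u≤v ⟩
    v ^ e          ∎
  where open ≤-Reasoning

2x≤x+y : ∀ {x y} → x ≤ y → 2 * x ≤ x + y
2x≤x+y {x} {y} x≤y = subst (_≤ x + y) (cong (x +_) (sym (+-identityʳ x))) (+-monoʳ-≤ x x≤y)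

2⌈n/2⌉≤1+n : ∀ n → 2 * ⌈ n /2⌉ ≤ suc n
2⌈n/2⌉≤1+n zero          = z≤n
2⌈n/2⌉≤1+n (suc zero)    = ≤-refl
2⌈n/2⌉≤1+n (suc (suc n)) =
  subst (_≤ 3 + n) (sym (*-suc 2 ⌈ n /2⌉)) (+-monoʳ-≤ 2 (2⌈n/2⌉≤1+n n))

2+n≤3⌊2+n/2⌋ : ∀ n → 2 + n ≤ 3 * ⌊ 2 + n /2⌋
2+n≤3⌊2+n/2⌋ zero          = m≤m+n 2 1
2+n≤3⌊2+n/2⌋ (suc zero)    = ≤-refl
2+n≤3⌊2+n/2⌋ (suc (suc n)) = begin
    4 + n                    ≤⟨ +-monoʳ-≤ 2 (2+n≤3⌊2+n/2⌋ n) ⟩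
    2 + 3 * ⌊ 2 + n /2⌋      ≤⟨ n≤1+n _ ⟩
    3 + 3 * ⌊ 2 + n /2⌋      ≡⟨ *-suc 3 ⌊ 2 + n /2⌋ ⟨
    3 * ⌊ 4 + n /2⌋          ∎
  where open ≤-Reasoning

-- The larger half h = ⌈N/2⌉ of N ≥ 2 satisfies 2h² ≤ N²; going from N to N + 2
-- adds 4h + 2 on the left and 4N + 4 on the right.
2⌈2+n/2⌉²≤⟨2+n⟩² : ∀ n → 2 * (⌈ 2 + n /2⌉ * ⌈ 2 + n /2⌉) ≤ (2 + n) * (2 + n)
2⌈2+n/2⌉²≤⟨2+n⟩² zero          = m≤m+n 2 2
2⌈2+n/2⌉²≤⟨2+n⟩² (suc zero)    = m≤m+n 8 1
2⌈2+n/2⌉²≤⟨2+n⟩² (suc (suc n)) = begin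
    2 * (suc h * suc h)        ≡⟨ lhs h ⟩
    2 * (h * h) + (4 * h + 2)  ≤⟨ +-mono-≤ (2⌈2+n/2⌉²≤⟨2+n⟩² n) (+-monoˡ-≤ 2 (*-monoʳ-≤ 4 (⌈n/2⌉≤n (2 + n)))) ⟩
    M * M + (4 * M + 2)        ≤⟨ +-monoʳ-≤ (M * M) (+-monoʳ-≤ (4 * M) (m≤m+n 2 2)) ⟩
    M * M + (4 * M + 4)        ≡⟨ rhs M ⟩
    (2 + M) * (2 + M)          ∎
  where
    open ≤-Reasoning
    h = ⌈ 2 + n /2⌉
    M = 2 + n
    lhs : ∀ h → 2 * (suc h * suc h) ≡ 2 * (h * h) + (4 * h + 2)
    lhs = solve-∀
    rhs : ∀ M → M * M + (4 * M + 4) ≡ (2 + M) * (2 + M)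
    rhs = solve-∀

record BalancedSplit (a b N : ℕ) : Set where
  field
    a+b≡N   : a + b ≡ N
    a≡⌈N/2⌉ : a ≡ ⌈ N /2⌉
    b≤a     : b ≤ a
    1≤b     : 1 ≤ b
    N≤3b    : N ≤ 3 * b
    2a²≤N²  : 2 * (a * a) ≤ N * N

  N≤2a : N ≤ 2 * a
  N≤2a = subst (_≤ 2 * a) a+b≡N
           (≤-trans (+-monoʳ-≤ a b≤a) (≤-reflexive (cong (a +_) (sym (+-identityʳ a)))))

  a≤N : a ≤ N
  a≤N = subst (a ≤_) a+b≡N (m≤m+n a b)

  a<N : a < N
  a<N = subst (suc a ≤_) a+b≡N (subst (_≤ a + b) (+-comm a 1) (+-monoʳ-≤ a 1≤b))

  1≤a : 1 ≤ a
  1≤a = ≤-trans 1≤b b≤a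

open BalancedSplit

balancedHalves : ∀ N → 2 ≤ N → BalancedSplit ⌈ N /2⌉ ⌊ N /2⌋ N
balancedHalves (suc zero)    (s≤s ())
balancedHalves (suc (suc n)) _ = record
  { a+b≡N   = trans (+-comm ⌈ 2 + n /2⌉ ⌊ 2 + n /2⌋) (⌊n/2⌋+⌈n/2⌉≡n (2 + n))
  ; a≡⌈N/2⌉ = refl
  ; b≤a     = ⌊n/2⌋≤⌈n/2⌉ (2 + n)
  ; 1≤b     = s≤s z≤n
  ; N≤3b    = 2+n≤3⌊2+n/2⌋ n
  ; 2a²≤N²  = 2⌈2+n/2⌉²≤⟨2+n⟩² n
  }

-- A chain with at most one point has no edges, hence is simple; so the chain of
-- an inner node has at least two points.
short-simple : ∀ (C : Chain) → length C ≤ 1 → Simple C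
short-simple []          _         = (λ ()) , (λ ())
short-simple (_ ∷ [])    _         = (λ ()) , (λ ())
short-simple (_ ∷ _ ∷ _) (s≤s ())

non-simple-size : ∀ (C : Chain) → ¬ Simple C → 2 ≤ length C
non-simple-size []          ¬simple = ⊥-elim (¬simple (short-simple [] z≤n))
non-simple-size (p ∷ [])    ¬simple = ⊥-elim (¬simple (short-simple (p ∷ []) ≤-refl))
non-simple-size (_ ∷ _ ∷ _) _       = s≤s (s≤s z≤n)

length-take-half : ∀ (C : Chain) → length (take ⌈ length C /2⌉ C) ≡ ⌈ length C /2⌉
length-take-half C = trans (length-take ⌈ length C /2⌉ C) (m≤n⇒m⊓n≡m (⌈n/2⌉≤n (length C)))

length-drop-half : ∀ (C : Chain) → length (drop ⌈ length C /2⌉ C) ≡ ⌊ length C /2⌋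
length-drop-half C = begin
    length (drop ⌈ N /2⌉ C)      ≡⟨ length-drop ⌈ N /2⌉ C ⟩
    N ∸ ⌈ N /2⌉                  ≡⟨ cong (_∸ ⌈ N /2⌉) (⌊n/2⌋+⌈n/2⌉≡n N) ⟨
    ⌊ N /2⌋ + ⌈ N /2⌉ ∸ ⌈ N /2⌉  ≡⟨ m+n∸n≡m ⌊ N /2⌋ ⌈ N /2⌉ ⟩
    ⌊ N /2⌋                      ∎
  where
    open ≡-Reasoning
    N = length C

nodeSplit : ∀ (C : Chain) → ¬ Simple C →
  BalancedSplit (length (take ⌈ length C /2⌉ C)) (length (drop ⌈ length C /2⌉ C)) (length C)
nodeSplit C ¬simple =
  subst₂ (λ a b → BalancedSplit a b (length C)) (sym (length-take-half C)) (sym (length-drop-half C))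
    (balancedHalves (length C) (non-simple-size C ¬simple))

module _ {a b N : ℕ} (split : BalancedSplit a b N) where

  2a^k≤N^k : ∀ {k} → 2 ≤ k → 2 * a ^ k ≤ N ^ k
  2a^k≤N^k {suc zero}    (s≤s ())
  2a^k≤N^k {suc (suc j)} _ = begin
      2 * (a * (a * a ^ j))   ≡⟨ reassoc a (a ^ j) ⟩
      2 * (a * a) * a ^ j     ≤⟨ *-mono-≤ (2a²≤N² split) (^-monoˡ-≤ j (a≤N split)) ⟩
      N * N * N ^ j           ≡⟨ *-assoc N N (N ^ j) ⟩
      N * (N * N ^ j)         ∎
    where
      open ≤-Reasoning
      reassoc : ∀ a x → 2 * (a * (a * x)) ≡ 2 * (a * a) * x
      reassoc = solve-∀

  -- 2^N · a^(ka) · b^(kb) ≤ N^(kN): in k·Σ ℓ log(N/ℓ), the drop from N to the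
  -- halves pays for the node's own cost N.
  cost-split : ∀ {k} → 2 ≤ k → 2 ^ N * (a ^ (k * a) * b ^ (k * b)) ≤ N ^ (k * N)
  cost-split {k} 2≤k = begin
      2 ^ N * (a ^ (k * a) * b ^ (k * b))  ≤⟨ *-monoʳ-≤ (2 ^ N) (*-monoʳ-≤ (a ^ (k * a)) (^-monoˡ-≤ (k * b) (b≤a split))) ⟩
      2 ^ N * (a ^ (k * a) * a ^ (k * b))  ≡⟨ cong (2 ^ N *_) (^-*-split a k a b (a+b≡N split)) ⟩
      2 ^ N * a ^ (k * N)                  ≡⟨ cong (2 ^ N *_) (^-*-assoc a k N) ⟨
      2 ^ N * (a ^ k) ^ N                  ≡⟨ *-^-distrib 2 (a ^ k) N ⟨
      (2 * a ^ k) ^ N                      ≤⟨ ^-monoˡ-≤ N (2a^k≤N^k 2≤k) ⟩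
      (N ^ k) ^ N                          ≡⟨ ^-*-assoc N k N ⟩
      N ^ (k * N)                          ∎
    where open ≤-Reasoning

  cost-node : ∀ {k cl cr Pl Pr} → 2 ≤ k →
    2 ^ cl * Pl ≤ 2 ^ (k * a) * a ^ (k * a) →
    2 ^ cr * Pr ≤ 2 ^ (k * b) * b ^ (k * b) →
    2 ^ (N + cl + cr) * (Pl * Pr) ≤ 2 ^ (k * N) * N ^ (k * N)
  cost-node {k} {cl} {cr} {Pl} {Pr} 2≤k left right = begin
      2 ^ (N + cl + cr) * (Pl * Pr)                ≡⟨ ^-node-weighted 2 N cl cr Pl Pr ⟩
      2 ^ N * ((2 ^ cl * Pl) * (2 ^ cr * Pr))      ≤⟨ *-monoʳ-≤ (2 ^ N) (*-mono-≤ left right) ⟩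
      2 ^ N * ((2 ^ ka * a ^ ka) * (2 ^ kb * b ^ kb))  ≡⟨ cong (2 ^ N *_) (interchange (2 ^ ka) (a ^ ka) (2 ^ kb) (b ^ kb)) ⟩
      2 ^ N * ((2 ^ ka * 2 ^ kb) * (a ^ ka * b ^ kb))  ≡⟨ x∙yz≈y∙xz (2 ^ N) (2 ^ ka * 2 ^ kb) (a ^ ka * b ^ kb) ⟩
      (2 ^ ka * 2 ^ kb) * (2 ^ N * (a ^ ka * b ^ kb))  ≤⟨ *-monoʳ-≤ (2 ^ ka * 2 ^ kb) (cost-split 2≤k) ⟩
      (2 ^ ka * 2 ^ kb) * N ^ (k * N)              ≡⟨ cong (_* N ^ (k * N)) (^-*-split 2 k a b (a+b≡N split)) ⟩
      2 ^ (k * N) * N ^ (k * N)                    ∎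
    where
      open ≤-Reasoning
      ka = k * a
      kb = k * b

  -- N^N ≤ 4^N · a^a · b^b, as each half is at least N/4.
  entropy-split : N ^ N ≤ 4 ^ N * (a ^ a * b ^ b)
  entropy-split = begin
      N ^ N                            ≡⟨ cong (N ^_) (a+b≡N split) ⟨
      N ^ (a + b)                      ≡⟨ ^-distribˡ-+-* N a b ⟩
      N ^ a * N ^ b                    ≤⟨ *-mono-≤ (^-monoˡ-≤ a N≤4a) (^-monoˡ-≤ b N≤4b) ⟩
      (4 * a) ^ a * (4 * b) ^ b        ≡⟨ cong₂ _*_ (*-^-distrib 4 a a) (*-^-distrib 4 b b) ⟩
      4 ^ a * a ^ a * (4 ^ b * b ^ b)  ≡⟨ interchange (4 ^ a) (a ^ a) (4 ^ b) (b ^ b) ⟩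
      4 ^ a * 4 ^ b * (a ^ a * b ^ b)  ≡⟨ cong (_* (a ^ a * b ^ b)) (^-split 4 a b (a+b≡N split)) ⟩
      4 ^ N * (a ^ a * b ^ b)          ∎
    where
      open ≤-Reasoning
      N≤4a : N ≤ 4 * a
      N≤4a = ≤-trans (N≤2a split) (*-monoˡ-≤ a (m≤m+n 2 2))
      N≤4b : N ≤ 4 * b
      N≤4b = ≤-trans (N≤3b split) (*-monoˡ-≤ b (m≤m+n 3 1))

  entropy-node : ∀ {cl cr Pl Pr} →
    a ^ a ≤ 4 ^ cl * Pl → b ^ b ≤ 4 ^ cr * Pr → N ^ N ≤ 4 ^ (N + cl + cr) * (Pl * Pr)
  entropy-node {cl} {cr} {Pl} {Pr} left right = begin
      N ^ N                                    ≤⟨ entropy-split ⟩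
      4 ^ N * (a ^ a * b ^ b)                  ≤⟨ *-monoʳ-≤ (4 ^ N) (*-mono-≤ left right) ⟩
      4 ^ N * ((4 ^ cl * Pl) * (4 ^ cr * Pr))  ≡⟨ ^-node-weighted 4 N cl cr Pl Pr ⟨
      4 ^ (N + cl + cr) * (Pl * Pr)            ∎
    where open ≤-Reasoning

  -- 2^N · x^(3a) · y^(3b) ≤ (x + y)^(3N): the factor 2^N is absorbed by the
  -- power of the smaller of x and y, which is at most half of x + y.
  leafCount-split : ∀ x y → 2 ^ N * (x ^ (3 * a) * y ^ (3 * b)) ≤ (x + y) ^ (3 * N)
  leafCount-split x y with ≤-total x y
  ... | inj₁ x≤y = begin
      2 ^ N * (x ^ (3 * a) * y ^ (3 * b))    ≡⟨ *-assoc (2 ^ N) _ _ ⟨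
      2 ^ N * x ^ (3 * a) * y ^ (3 * b)      ≤⟨ *-mono-≤ (absorb-2^ (2x≤x+y x≤y) N≤3a) (^-monoˡ-≤ (3 * b) (m≤n+m y x)) ⟩
      (x + y) ^ (3 * a) * (x + y) ^ (3 * b)  ≡⟨ ^-*-split (x + y) 3 a b (a+b≡N split) ⟩
      (x + y) ^ (3 * N)                      ∎
    where
      open ≤-Reasoning
      N≤3a : N ≤ 3 * a
      N≤3a = ≤-trans (N≤2a split) (*-monoˡ-≤ a (m≤m+n 2 1))
  ... | inj₂ y≤x = begin
      2 ^ N * (x ^ (3 * a) * y ^ (3 * b))    ≡⟨ x∙yz≈y∙xz (2 ^ N) (x ^ (3 * a)) (y ^ (3 * b)) ⟩
      x ^ (3 * a) * (2 ^ N * y ^ (3 * b))    ≤⟨ *-mono-≤ (^-monoˡ-≤ (3 * a) (m≤m+n x y)) (absorb-2^ 2y≤x+y (N≤3b split)) ⟩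
      (x + y) ^ (3 * a) * (x + y) ^ (3 * b)  ≡⟨ ^-*-split (x + y) 3 a b (a+b≡N split) ⟩
      (x + y) ^ (3 * N)                      ∎
    where
      open ≤-Reasoning
      2y≤x+y : 2 * y ≤ x + y
      2y≤x+y = subst (2 * y ≤_) (+-comm y x) (2x≤x+y y≤x)

  leafCount-node : ∀ {cl cr ml mr} →
    2 ^ cl ≤ 2 ^ a * ml ^ (3 * a) → 2 ^ cr ≤ 2 ^ b * mr ^ (3 * b) →
    2 ^ (N + cl + cr) ≤ 2 ^ N * (ml + mr) ^ (3 * N)
  leafCount-node {cl} {cr} {ml} {mr} left right = begin
      2 ^ (N + cl + cr)                                  ≡⟨ ^-node 2 N cl cr ⟩
      2 ^ N * (2 ^ cl * 2 ^ cr)                          ≤⟨ *-monoʳ-≤ (2 ^ N) (*-mono-≤ left right) ⟩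
      2 ^ N * ((2 ^ a * ml ^ (3 * a)) * (2 ^ b * mr ^ (3 * b)))
        ≡⟨ cong (2 ^ N *_) (interchange (2 ^ a) (ml ^ (3 * a)) (2 ^ b) (mr ^ (3 * b))) ⟩
      2 ^ N * ((2 ^ a * 2 ^ b) * (ml ^ (3 * a) * mr ^ (3 * b)))
        ≡⟨ cong (λ z → 2 ^ N * (z * (ml ^ (3 * a) * mr ^ (3 * b)))) (^-split 2 a b (a+b≡N split)) ⟩
      2 ^ N * (2 ^ N * (ml ^ (3 * a) * mr ^ (3 * b)))    ≤⟨ *-monoʳ-≤ (2 ^ N) (leafCount-split ml mr) ⟩
      2 ^ N * (ml + mr) ^ (3 * N)                        ∎
    where open ≤-Reasoning

product-map-++ : ∀ (f : ℕ → ℕ) xs ys →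
  product (map f (xs ++ ys)) ≡ product (map f xs) * product (map f ys)
product-map-++ f xs ys = trans (cong product (map-++ f xs ys)) (product-++ (map f xs) (map f ys))

leafPowers : ℕ → List ℕ → ℕ
leafPowers k ls = product (map (λ ℓ → ℓ ^ (k * ℓ)) ls)

selfPowers : List ℕ → ℕ
selfPowers ls = product (map (λ ℓ → ℓ ^ ℓ) ls)

leafSizes-sum : ∀ {C} (t : RecTree C) → sum (leafSizes t) ≡ length C
leafSizes-sum {C} (leaf _)           = +-identityʳ (length C)
leafSizes-sum {C} (node ¬simple l r) = begin
    sum (leafSizes l ++ leafSizes r)       ≡⟨ sum-++ (leafSizes l) (leafSizes r) ⟩
    sum (leafSizes l) + sum (leafSizes r)  ≡⟨ cong₂ _+_ (leafSizes-sum l) (leafSizes-sum r) ⟩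
    _                                      ≡⟨ a+b≡N (nodeSplit C ¬simple) ⟩
    length C                               ∎
  where open ≡-Reasoning

-- (i) cost ≤ k·N·(1 + H) for every k ≥ 2.
cost-bound : ∀ {k} → 2 ≤ k → ∀ {C} (t : RecTree C) →
  2 ^ cost t * leafPowers k (leafSizes t) ≤ 2 ^ (k * length C) * length C ^ (k * length C)
cost-bound 2≤k (leaf _) =
  *-mono-≤ (^-monoʳ-≤ 2 (n≤k*n (≤-trans (n≤1+n 1) 2≤k))) (≤-reflexive (*-identityʳ _))
cost-bound {k} 2≤k {C} (node ¬simple l r) = begin
    2 ^ cost (node ¬simple l r) * leafPowers k (leafSizes l ++ leafSizes r)
      ≡⟨ cong (2 ^ cost (node ¬simple l r) *_) (product-map-++ _ (leafSizes l) (leafSizes r)) ⟩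
    2 ^ cost (node ¬simple l r) * (leafPowers k (leafSizes l) * leafPowers k (leafSizes r))
      ≤⟨ cost-node (nodeSplit C ¬simple) 2≤k (cost-bound 2≤k l) (cost-bound 2≤k r) ⟩
    2 ^ (k * length C) * length C ^ (k * length C) ∎
  where open ≤-Reasoning

-- (ii) N·H ≤ 2·cost.
entropy-bound : ∀ {C} (t : RecTree C) →
  length C ^ length C ≤ 4 ^ cost t * selfPowers (leafSizes t)
entropy-bound {C} (leaf _) =
  ≤-trans (≤-reflexive (sym (*-identityʳ _))) (n≤k*n (m^n>0 4 (length C)))
entropy-bound {C} (node ¬simple l r) = begin
    length C ^ length C
      ≤⟨ entropy-node (nodeSplit C ¬simple) (entropy-bound l) (entropy-bound r) ⟩
    4 ^ cost (node ¬simple l r) * (selfPowers (leafSizes l) * selfPowers (leafSizes r))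
      ≡⟨ cong (4 ^ cost (node ¬simple l r) *_) (product-map-++ _ (leafSizes l) (leafSizes r)) ⟨
    4 ^ cost (node ¬simple l r) * selfPowers (leafSizes l ++ leafSizes r) ∎
  where open ≤-Reasoning

-- (iii) cost ≤ N + 3N·log m, for m the number of leaves.
leafCount-bound : ∀ {C} (t : RecTree C) →
  2 ^ cost t ≤ 2 ^ length C * length (leafSizes t) ^ (3 * length C)
leafCount-bound {C} (leaf _) =
  ≤-reflexive (sym (trans (cong (2 ^ length C *_) (^-zeroˡ (3 * length C))) (*-identityʳ _)))
leafCount-bound {C} (node ¬simple l r) = begin
    2 ^ cost (node ¬simple l r)
      ≤⟨ leafCount-node (nodeSplit C ¬simple) (leafCount-bound l) (leafCount-bound r) ⟩
    2 ^ length C * (length (leafSizes l) + length (leafSizes r)) ^ (3 * length C)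
      ≡⟨ cong (λ m → 2 ^ length C * m ^ (3 * length C)) (length-++ (leafSizes l)) ⟨
    2 ^ length C * length (leafSizes l ++ leafSizes r) ^ (3 * length C) ∎
  where open ≤-Reasoning

-- A node at depth d has size at most n_d, where n₀ = N and n_{d+1} = ⌈n_d/2⌉.
-- Given the node counts cs of the levels, levelWeight cs N = Σ_d cs_d · n_d
-- therefore bounds the cost.
levelWeight : List ℕ → ℕ → ℕ
levelWeight []       n = 0
levelWeight (c ∷ cs) n = c * n + levelWeight cs ⌈ n /2⌉

levelWeight-addLevels : ∀ xs ys n →
  levelWeight (addLevels xs ys) n ≡ levelWeight xs n + levelWeight ys n
levelWeight-addLevels []       ys       n = refl
levelWeight-addLevels (x ∷ xs) []       n = sym (+-identityʳ _)
levelWeight-addLevels (x ∷ xs) (y ∷ ys) n = begin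
    (x + y) * n + levelWeight (addLevels xs ys) h
      ≡⟨ cong₂ _+_ (*-distribʳ-+ n x y) (levelWeight-addLevels xs ys h) ⟩
    (x * n + y * n) + (levelWeight xs h + levelWeight ys h)
      ≡⟨ +-interchange (x * n) (y * n) (levelWeight xs h) (levelWeight ys h) ⟩
    (x * n + levelWeight xs h) + (y * n + levelWeight ys h) ∎
  where
    open ≡-Reasoning
    h = ⌈ n /2⌉

levelWeight-mono : ∀ cs {n n′} → n ≤ n′ → levelWeight cs n ≤ levelWeight cs n′
levelWeight-mono []       _    = z≤n
levelWeight-mono (c ∷ cs) n≤n′ = +-mono-≤ (*-monoʳ-≤ c n≤n′) (levelWeight-mono cs (⌈n/2⌉-mono n≤n′))

-- The children of a node of size N have sizes at most ⌈N/2⌉.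
cost≤levelWeight : ∀ {C} (t : RecTree C) → cost t ≤ levelWeight (levelCounts t) (length C)
cost≤levelWeight (leaf _)               = ≤-reflexive (sym (trans (+-identityʳ _) (*-identityˡ _)))
cost≤levelWeight {C} (node ¬simple l r) = begin
    length C + cost l + cost r
      ≤⟨ +-mono-≤ (+-monoʳ-≤ (length C) (≤-trans (cost≤levelWeight l) (levelWeight-mono Ll a≤h)))
                  (≤-trans (cost≤levelWeight r) (levelWeight-mono Lr b≤h)) ⟩
    length C + levelWeight Ll h + levelWeight Lr h
      ≡⟨ +-assoc (length C) _ _ ⟩
    length C + (levelWeight Ll h + levelWeight Lr h)
      ≡⟨ cong₂ _+_ (*-identityˡ (length C)) (levelWeight-addLevels Ll Lr h) ⟨
    1 * length C + levelWeight (addLevels Ll Lr) h ∎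
  where
    open ≤-Reasoning
    split = nodeSplit C ¬simple
    h  = ⌈ length C /2⌉
    Ll = levelCounts l
    Lr = levelCounts r
    a≤h = ≤-reflexive (a≡⌈N/2⌉ split)
    b≤h = ≤-trans (b≤a split) a≤h

-- The sizes n_d decrease geometrically, so Σ_{d<D} n_d ≤ 2N + D; with at most w
-- nodes per level this gives levelWeight ≤ w · (2N + D).
levelWeight≤ : ∀ cs n w → foldr _⊔_ 0 cs ≤ w → levelWeight cs n ≤ w * (2 * n + length cs)
levelWeight≤ []       n w _     = z≤n
levelWeight≤ (c ∷ cs) n w max≤w = begin
    c * n + levelWeight cs h               ≤⟨ +-mono-≤ (*-monoˡ-≤ n c≤w) (levelWeight≤ cs h w cs≤w) ⟩
    w * n + w * (2 * h + length cs)        ≡⟨ *-distribˡ-+ w n _ ⟨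
    w * (n + (2 * h + length cs))          ≤⟨ *-monoʳ-≤ w (+-monoʳ-≤ n (+-monoˡ-≤ (length cs) (2⌈n/2⌉≤1+n n))) ⟩
    w * (n + (suc n + length cs))          ≡⟨ cong (w *_) (rearrange n (length cs)) ⟩
    w * (2 * n + suc (length cs))          ∎
  where
    open ≤-Reasoning
    h = ⌈ n /2⌉
    c≤w  = ≤-trans (m≤m⊔n c _) max≤w
    cs≤w = ≤-trans (m≤n⊔m c _) max≤w
    rearrange : ∀ n D → n + (suc n + D) ≡ 2 * n + suc D
    rearrange = solve-∀

length-addLevels : ∀ xs ys → length (addLevels xs ys) ≤ length xs ⊔ length ys
length-addLevels []       ys       = ≤-refl
length-addLevels (x ∷ xs) []       = ≤-refl
length-addLevels (x ∷ xs) (y ∷ ys) = s≤s (length-addLevels xs ys)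

-- The depth is less than the size, since every split strictly shrinks the chain.
depth≤size : ∀ {C} (t : RecTree C) → 1 ≤ length C → length (levelCounts t) ≤ length C
depth≤size (leaf _)               1≤N = 1≤N
depth≤size {C} (node ¬simple l r) _   = begin
    suc (length (addLevels (levelCounts l) (levelCounts r)))
      ≤⟨ s≤s (length-addLevels (levelCounts l) (levelCounts r)) ⟩
    suc (length (levelCounts l) ⊔ length (levelCounts r))
      ≤⟨ s≤s (⊔-mono-≤ (depth≤size l (1≤a split)) (depth≤size r (1≤b split))) ⟩
    suc (a ⊔ b)  ≤⟨ s≤s (⊔-lub ≤-refl (b≤a split)) ⟩
    suc a        ≤⟨ a<N split ⟩
    length C     ∎
  where
    open ≤-Reasoning
    split = nodeSplit C ¬simple
    a = length (take ⌈ length C /2⌉ C)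
    b = length (drop ⌈ length C /2⌉ C)

-- (iv) cost ≤ 3wN.
cost≤width : ∀ {C} (t : RecTree C) → 1 ≤ length C →
  cost t ≤ width t * (2 * length C + length C)
cost≤width {C} t 1≤N =
  ≤-trans (cost≤levelWeight t)
    (≤-trans (levelWeight≤ (levelCounts t) (length C) (width t) ≤-refl)
      (*-monoʳ-≤ (width t) (+-monoʳ-≤ (2 * length C) (depth≤size t 1≤N))))

1≤width : ∀ {C} (t : RecTree C) → 1 ≤ width t
1≤width (leaf _)     = ≤-refl
1≤width (node _ l r) = m≤m⊔n 1 (foldr _⊔_ 0 (addLevels (levelCounts l) (levelCounts r)))

1≤leafCount : ∀ {C} (t : RecTree C) → 1 ≤ length (leafSizes t)
1≤leafCount (leaf _)     = ≤-refl
1≤leafCount (node _ l r) =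
  subst (1 ≤_) (sym (length-++ (leafSizes l))) (≤-trans (1≤leafCount l) (m≤m+n _ _))

1≤selfPowers : ∀ ls → 1 ≤ selfPowers ls
1≤selfPowers []       = ≤-refl
1≤selfPowers (ℓ ∷ ls) = *-mono-≤ (1≤ℓ^ℓ ℓ) (1≤selfPowers ls)
  where
    1≤ℓ^ℓ : ∀ ℓ → 1 ≤ ℓ ^ ℓ
    1≤ℓ^ℓ zero    = ≤-refl
    1≤ℓ^ℓ (suc ℓ) = m^n>0 (suc ℓ) (suc ℓ)

running-time-bound : ∀ {C} (t : RecTree C) → CostLe (cost t) 7 (leafSizes t)
running-time-bound t rewrite leafSizes-sum t = cost-bound (m≤m+n 2 5) t

-- N(1 + H) ≤ N + 2·cost, by (ii).
entropy≤cost : ∀ {C} (t : RecTree C) →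
  2 ^ length C * length C ^ length C ≤ 2 ^ length C * 4 ^ cost t * selfPowers (leafSizes t)
entropy≤cost {C} t =
  ≤-trans (*-monoʳ-≤ (2 ^ length C) (entropy-bound t))
          (≤-reflexive (sym (*-assoc (2 ^ length C) (4 ^ cost t) (selfPowers (leafSizes t)))))

-- (b) N(1 + H) ≤ 7wN, by (ii) and (iv).
entropy≤width : ∀ {C} (t : RecTree C) → 1 ≤ length C → EntLeMul 7 (width t) (leafSizes t)
entropy≤width {C} t 1≤N rewrite leafSizes-sum t = begin
    2 ^ N * N ^ N            ≤⟨ entropy≤cost t ⟩
    2 ^ N * 4 ^ c * P        ≡⟨ cong (λ z → 2 ^ N * z * P) (^-*-assoc 2 2 c) ⟩
    2 ^ N * 2 ^ (2 * c) * P  ≡⟨ cong (_* P) (^-distribˡ-+-* 2 N (2 * c)) ⟨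
    2 ^ (N + 2 * c) * P      ≤⟨ *-monoˡ-≤ P (^-monoʳ-≤ 2 exponent) ⟩
    2 ^ (7 * w * N) * P      ∎
  where
    open ≤-Reasoning
    N = length C
    w = width t
    c = cost t
    P = selfPowers (leafSizes t)
    collect : ∀ w N → w * N + 2 * (w * (2 * N + N)) ≡ 7 * w * N
    collect = solve-∀
    exponent : N + 2 * c ≤ 7 * w * N
    exponent = begin
      N + 2 * c                       ≤⟨ +-mono-≤ (n≤k*n (1≤width t)) (*-monoʳ-≤ 2 (cost≤width t 1≤N)) ⟩
      w * N + 2 * (w * (2 * N + N))   ≡⟨ collect w N ⟩
      7 * w * N                       ∎

-- (c) N(1 + H) ≤ 7N(1 + log m), by (ii) and (iii).
entropy≤leafCount : ∀ {C} (t : RecTree C) → EntLeLog 7 (length (leafSizes t)) (leafSizes t)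
entropy≤leafCount {C} t rewrite leafSizes-sum t = begin
    2 ^ N * N ^ N                    ≤⟨ entropy≤cost t ⟩
    2 ^ N * 4 ^ c * P                ≤⟨ *-monoˡ-≤ P powers ⟩
    2 ^ (7 * N) * m ^ (7 * N) * P    ∎
  where
    open ≤-Reasoning
    N = length C
    m = length (leafSizes t)
    c = cost t
    P = selfPowers (leafSizes t)
    M = m ^ (3 * N)
    triple : ∀ N → N + N + N ≡ 3 * N
    triple = solve-∀
    3N≤7N : N + N + N ≤ 7 * N
    3N≤7N = ≤-trans (≤-reflexive (triple N)) (*-monoˡ-≤ N (m≤m+n 3 4))
    6N≤7N : 3 * N + 3 * N ≤ 7 * N
    6N≤7N = ≤-trans (≤-reflexive (sym (*-distribʳ-+ N 3 3))) (*-monoˡ-≤ N (m≤m+n 6 1))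
    powers : 2 ^ N * 4 ^ c ≤ 2 ^ (7 * N) * m ^ (7 * N)
    powers = begin
      2 ^ N * 4 ^ c                       ≡⟨ cong (2 ^ N *_) (*-^-distrib 2 2 c) ⟩
      2 ^ N * (2 ^ c * 2 ^ c)             ≤⟨ *-monoʳ-≤ (2 ^ N) (*-mono-≤ (leafCount-bound t) (leafCount-bound t)) ⟩
      2 ^ N * ((2 ^ N * M) * (2 ^ N * M)) ≡⟨ cong (2 ^ N *_) (interchange (2 ^ N) M (2 ^ N) M) ⟩
      2 ^ N * ((2 ^ N * 2 ^ N) * (M * M)) ≡⟨ *-assoc (2 ^ N) _ _ ⟨
      2 ^ N * (2 ^ N * 2 ^ N) * (M * M)   ≡⟨ cong₂ _*_ (^-node 2 N N N) (^-distribˡ-+-* m (3 * N) (3 * N)) ⟨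
      2 ^ (N + N + N) * m ^ (3 * N + 3 * N)
        ≤⟨ *-mono-≤ (^-monoʳ-≤ 2 3N≤7N) (^-monoʳ-≤ m {{>-nonZero (1≤leafCount t)}} 6N≤7N) ⟩
      2 ^ (7 * N) * m ^ (7 * N)           ∎

-- (d) N(1 + H) ≤ 7N(1 + log N), since Πᵢ ℓᵢ^ℓᵢ ≥ 1.
entropy≤size : ∀ {C} (t : RecTree C) → 1 ≤ length C → EntLeLog 7 (length C) (leafSizes t)
entropy≤size {C} t 1≤N rewrite leafSizes-sum t = begin
    2 ^ N * N ^ N                  ≤⟨ *-mono-≤ (^-monoʳ-≤ 2 N≤7N) (^-monoʳ-≤ N {{>-nonZero 1≤N}} N≤7N) ⟩
    2 ^ (7 * N) * N ^ (7 * N)      ≡⟨ *-identityʳ _ ⟨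
    2 ^ (7 * N) * N ^ (7 * N) * 1  ≤⟨ *-monoʳ-≤ (2 ^ (7 * N) * N ^ (7 * N)) (1≤selfPowers (leafSizes t)) ⟩
    2 ^ (7 * N) * N ^ (7 * N) * selfPowers (leafSizes t) ∎
  where
    open ≤-Reasoning
    N = length C
    N≤7N = n≤k*n {7} {N} (s≤s z≤n)

lemma2 : ∃[ c ] ∀ (C : Chain) → 1 ≤ length C → (t : RecTree C) →
           sum (leafSizes t) ≡ length C
           × CostLe (cost t) c (leafSizes t)
           × EntLeMul c (width t) (leafSizes t)
           × EntLeLog c (length (leafSizes t)) (leafSizes t)
           × EntLeLog c (length C) (leafSizes t)
lemma2 = 7 , λ C 1≤N t →
  leafSizes-sum t , running-time-bound t , entropy≤width t 1≤N ,
  entropy≤leafCount t , entropy≤size t 1≤N
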